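{- Let $\nu(y,z;q):=\sum_{n=0}^{\infty} \frac{y^nz^nq^{n^2+n}}{(yq;q^2)_{n+1}}$. Then $$\nu(y,z;q)=\sum_{n=0}^{\infty}(-zq;q^2)_n\,(yq)^n,$$ as an identity of formal power series in $q$ (equivalently, of analytic functions for $|q|<1$ and $y,z$ in a suitable neighbourhood).
   Context: For $n\ge 1$, $(a;q)_0:=1$ and $(a;q)_n:=(1-a)(1-aq)\cdots(1-aq^{n-1})$. Here $y,z$ are indeterminates. -}

module Defs where

open import Data.Nat using (ℕ; zero; suc; _∸_)
import Data.Nat as N
open import Data.Integer using (ℤ; 0ℤ; 1ℤ; _+_; _*_; -_)

-- Formal power series in q whose coefficients lie in ℤ[y,z] (more precisely
-- ℤ[[y,z]], which contains ℤ[y,z]).  A series F is given by its coefficients: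
-- F i j k = coefficient of q^i y^j z^k.
Series : Set
Series = ℕ → ℕ → ℕ → ℤ

sumTo : ℕ → (ℕ → ℤ) → ℤ
sumTo zero    f = f zero
sumTo (suc n) f = sumTo n f + f (suc n)

_⊕_ : Series → Series → Series
(F ⊕ G) i j k = F i j k + G i j k

⊖_ : Series → Series
(⊖ F) i j k = - F i j k

_⊗_ : Series → Series → Series
(F ⊗ G) i j k =
  sumTo i λ a → sumTo j λ b → sumTo k λ c →
    F a b c * G (i ∸ a) (j ∸ b) (k ∸ c)

infixl 6 _⊕_
infixl 7 _⊗_

𝟙 : Series
𝟙 zero zero zero = 1ℤ
𝟙 _    _    _    = 0ℤ

qS : Series
qS (suc zero) zero zero = 1ℤ
qS _          _    _    = 0ℤ

yS : Series
yS zero (suc zero) zero = 1ℤ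
yS _    _          _    = 0ℤ

zS : Series
zS zero zero (suc zero) = 1ℤ
zS _    _    _          = 0ℤ

_^ˢ_ : Series → ℕ → Series
F ^ˢ zero  = 𝟙
F ^ˢ suc n = F ^ˢ n ⊗ F

-- Infinite sum Σ_{t≥0} s t, for a sequence with q-order of (s t) ≥ t
-- (so the coefficient of q^i only receives contributions from t ≤ i).
-- All sequences summed below satisfy this order condition.
∑∞ : (ℕ → Series) → Series
∑∞ s i j k = sumTo i λ t → s t i j k

-- Multiplicative inverse of a series F with F ≡ 1 (mod q):
-- 1/F = Σ_{t≥0} (1 - F)^t.
inv : Series → Series
inv F = ∑∞ λ t → (𝟙 ⊕ ⊖ F) ^ˢ t

poch : Series → Series → ℕ → Series
poch a Q zero    = 𝟙
poch a Q (suc n) = poch a Q n ⊗ (𝟙 ⊕ ⊖ (a ⊗ Q ^ˢ n))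

ν : Series
ν = ∑∞ λ n → yS ^ˢ n ⊗ zS ^ˢ n ⊗ qS ^ˢ (n N.* n N.+ n)
               ⊗ inv (poch (yS ⊗ qS) (qS ^ˢ 2) (suc n))

rhs : Series
rhs = ∑∞ λ n → poch (⊖ (zS ⊗ qS)) (qS ^ˢ 2) n ⊗ (yS ⊗ qS) ^ˢ n

module Submission where

-- The proof compares coefficients.  The coefficient of q^i y^j z^k on the
-- right comes from the summand n = j alone and counts the k-element subsets
-- of {1, 3, …, 2j-1} with sum i - j.  On the left it comes from n = k alone
-- and counts the (j-k)-element multisets of {1, 3, …, 2k+1} with sum
-- i - k² - k; the two counts agree, being coefficients of the same Gaussian
-- binomial coefficient.

open import Defs
open import Data.Nat using (ℕ)
open import Relation.Binary.PropositionalEquality using (_≡_)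

open import Algebra.Bundles using (CommutativeMonoid; CommutativeRing)
open import Algebra.Structures using (IsCommutativeRing)
import Algebra.Construct.Pointwise as Pointwise
import Relation.Binary.Reasoning.Setoid as SetoidReasoning
open import Data.Nat as ℕ using (zero; suc; _∸_; _≤_; _<_; z≤n; s≤s; _≤?_; _<?_)
import Data.Nat.Properties as ℕₚ
open import Data.Integer as ℤ using (ℤ; +_; -[1+_]; 0ℤ; 1ℤ)
import Data.Integer.Properties as ℤₚ
open import Data.Integer.Tactic.RingSolver using (solve-∀)
open import Data.Product using (_,_)
open import Data.Empty using (⊥-elim)
open import Relation.Binary.PropositionalEquality as ≡ using (_≢_)
open import Relation.Nullary using (Dec; yes; no)

module FiniteSums {c ℓ} (M : CommutativeMonoid c ℓ) where
  open CommutativeMonoid M renaming (Carrier to A)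
  open Data.Nat using (_+_)
  open ℕₚ using (≤-refl; m≤n⇒m≤1+n; m≤n+m; n∸n≡0; +-∸-assoc; m+[n∸m]≡n; m∸n+n≡m; <⇒≢; >⇒≢; ≰⇒>; +-identityʳ)
  open SetoidReasoning setoid
  open import Algebra.Properties.CommutativeSemigroup commutativeSemigroup using (interchange)

  Σ : ℕ → (ℕ → A) → A
  Σ zero    f = f zero
  Σ (suc n) f = Σ n f ∙ f (suc n)

  Σ-cong : ∀ n {f g : ℕ → A} → (∀ a → a ≤ n → f a ≈ g a) → Σ n f ≈ Σ n g
  Σ-cong zero    f≈g = f≈g 0 z≤n
  Σ-cong (suc n) f≈g =
    ∙-cong (Σ-cong n λ a a≤n → f≈g a (m≤n⇒m≤1+n a≤n)) (f≈g (suc n) ≤-refl)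

  Σ-vanish : ∀ n {f : ℕ → A} → (∀ a → a ≤ n → f a ≈ ε) → Σ n f ≈ ε
  Σ-vanish zero    f≈ε = f≈ε 0 z≤n
  Σ-vanish (suc n) f≈ε =
    trans (∙-cong (Σ-vanish n λ a a≤n → f≈ε a (m≤n⇒m≤1+n a≤n)) (f≈ε (suc n) ≤-refl))
          (identityˡ ε)

  Σ-∙ : ∀ n (f g : ℕ → A) → Σ n (λ a → f a ∙ g a) ≈ Σ n f ∙ Σ n g
  Σ-∙ zero    f g = refl
  Σ-∙ (suc n) f g = trans (∙-congʳ (Σ-∙ n f g)) (interchange _ _ _ _)

  Σ-peel : ∀ n (f : ℕ → A) → Σ (suc n) f ≈ f 0 ∙ Σ n (λ a → f (suc a))
  Σ-peel zero    f = refl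
  Σ-peel (suc n) f = trans (∙-congʳ (Σ-peel n f)) (assoc _ _ _)

  Σ-reverse : ∀ n (f : ℕ → A) → Σ n f ≈ Σ n (λ a → f (n ∸ a))
  Σ-reverse zero    f = refl
  Σ-reverse (suc n) f = begin
    Σ n f ∙ f (suc n)                  ≈⟨ comm _ _ ⟩
    f (suc n) ∙ Σ n f                  ≈⟨ ∙-congˡ (Σ-reverse n f) ⟩
    f (suc n) ∙ Σ n (λ a → f (n ∸ a))  ≈⟨ Σ-peel n (λ a → f (suc n ∸ a)) ⟨
    Σ (suc n) (λ a → f (suc n ∸ a))    ∎

  Σ-last : ∀ n (f : ℕ → A) → (∀ a → a < n → f a ≈ ε) → Σ n f ≈ f n
  Σ-last zero    f _   = refl
  Σ-last (suc n) f f≈ε =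
    trans (∙-congʳ (Σ-vanish n λ a a≤n → f≈ε a (s≤s a≤n))) (identityˡ _)

  Σ-extend : ∀ m k (f : ℕ → A) → (∀ a → m < a → f a ≈ ε) → Σ (k + m) f ≈ Σ m f
  Σ-extend m zero    f _   = refl
  Σ-extend m (suc k) f f≈ε =
    trans (∙-cong (Σ-extend m k f f≈ε) (f≈ε _ (s≤s (m≤n+m m k)))) (identityʳ _)

  Σ-single : ∀ n k (f : ℕ → A) → (∀ a → a ≢ k → f a ≈ ε) → (n < k → f k ≈ ε) →
             Σ n f ≈ f k
  Σ-single n k f off outside with k ≤? n
  ... | yes k≤n = begin
    Σ n f                ≡⟨ ≡.cong (λ m → Σ m f) (m∸n+n≡m k≤n) ⟨
    Σ ((n ∸ k) + k) f    ≈⟨ Σ-extend k (n ∸ k) f (λ a k<a → off a (>⇒≢ k<a)) ⟩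
    Σ k f                ≈⟨ Σ-last k f (λ a a<k → off a (<⇒≢ a<k)) ⟩
    f k                  ∎
  ... | no k≰n = begin
    Σ n f  ≈⟨ Σ-vanish n (λ a a≤n → off a λ { ≡.refl → k≰n a≤n }) ⟩
    ε      ≈⟨ outside (≰⇒> k≰n) ⟨
    f k    ∎

  Σ-triangle : ∀ n (g : ℕ → ℕ → A) →
    Σ n (λ b → Σ b (λ a → g a b)) ≈ Σ n (λ a → Σ (n ∸ a) (λ d → g a (a + d)))
  Σ-triangle zero    g = refl
  Σ-triangle (suc n) g = begin
    Σ n (λ b → Σ b (λ a → g a b)) ∙ (Σ n (λ a → g a (suc n)) ∙ g (suc n) (suc n))
      ≈⟨ ∙-congʳ (Σ-triangle n g) ⟩
    Σ n inner ∙ (Σ n (λ a → g a (suc n)) ∙ g (suc n) (suc n))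
      ≈⟨ assoc _ _ _ ⟨
    (Σ n inner ∙ Σ n (λ a → g a (suc n))) ∙ g (suc n) (suc n)
      ≈⟨ ∙-congʳ (Σ-∙ n _ _) ⟨
    Σ n (λ a → inner a ∙ g a (suc n)) ∙ g (suc n) (suc n)
      ≈⟨ ∙-cong (Σ-cong n grow) (reflexive corner) ⟩
    Σ (suc n) (λ a → Σ (suc n ∸ a) (λ d → g a (a + d))) ∎
    where
    inner : ℕ → A
    inner a = Σ (n ∸ a) (λ d → g a (a + d))
    -- row a of the triangle gains the single entry g a (suc n) ...
    grow : ∀ a → a ≤ n → inner a ∙ g a (suc n) ≈ Σ (suc n ∸ a) (λ d → g a (a + d))
    grow a a≤n rewrite +-∸-assoc 1 a≤n =
      ∙-congˡ (reflexive (≡.cong (g a) (≡.trans (≡.sym (m+[n∸m]≡n (m≤n⇒m≤1+n a≤n)))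
                                                 (≡.cong (λ d → a + d) (+-∸-assoc 1 a≤n)))))
    -- ... and a new row of index suc n with one entry appears
    corner : g (suc n) (suc n) ≡ Σ (n ∸ n) (λ d → g (suc n) (suc n + d))
    corner = ≡.trans (≡.cong (g (suc n)) (≡.sym (+-identityʳ (suc n))))
                     (≡.cong (λ m → Σ m (λ d → g (suc n) (suc n + d))) (≡.sym (n∸n≡0 n)))

-- x ^ n in a commutative ring, multiplying on the right (as _^ˢ_ does).
power : ∀ {c ℓ} (R : CommutativeRing c ℓ) → CommutativeRing.Carrier R → ℕ → CommutativeRing.Carrier R
power R x zero    = CommutativeRing.1# R
power R x (suc n) = CommutativeRing._*_ R (power R x n) x

module PowerSeries {c ℓ} (R : CommutativeRing c ℓ) where
  open CommutativeRing R renaming (Carrier to A) hiding (zero)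
  open ℕₚ using (≤-refl; ≤-trans; +-suc; n∸n≡0; +-∸-assoc; m∸[m∸n]≡n; m+n∸m≡n; ∸-+-assoc; m≤n⇒m∸n≡0; ≮⇒≥; m∸n+n≡m)
  open SetoidReasoning setoid
  open import Algebra.Properties.Ring ring using (-‿distribʳ-*; -‿+-comm; -‿involutive; -0#≈0#)
  open FiniteSums +-commutativeMonoid public

  Σ-distribˡ : ∀ n x (f : ℕ → A) → x * Σ n f ≈ Σ n (λ a → x * f a)
  Σ-distribˡ zero    x f = refl
  Σ-distribˡ (suc n) x f = trans (distribˡ x _ _) (+-congʳ (Σ-distribˡ n x f))

  Σ-distribʳ : ∀ n x (f : ℕ → A) → Σ n f * x ≈ Σ n (λ a → f a * x)
  Σ-distribʳ zero    x f = refl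
  Σ-distribʳ (suc n) x f = trans (distribʳ x _ _) (+-congʳ (Σ-distribʳ n x f))

  Σ-negate : ∀ n (f : ℕ → A) → - Σ n f ≈ Σ n (λ a → - f a)
  Σ-negate zero    f = refl
  Σ-negate (suc n) f = trans (sym (-‿+-comm _ _)) (+-congʳ (Σ-negate n f))

  Ser : Set c
  Ser = ℕ → A

  infix  4 _≋_
  infixl 6 _⊞_
  infixl 7 _⊠_

  _≋_ : Ser → Ser → Set ℓ
  F ≋ G = ∀ n → F n ≈ G n

  _⊞_ : Ser → Ser → Ser
  (F ⊞ G) n = F n + G n

  ⊟ : Ser → Ser
  ⊟ F n = - F n

  𝟘 : Ser
  𝟘 _ = 0#

  _⊠_ : Ser → Ser → Ser
  (F ⊠ G) n = Σ n (λ a → F a * G (n ∸ a))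

  ⊠-cong : ∀ {F F′ G G′} → F ≋ F′ → G ≋ G′ → F ⊠ G ≋ F′ ⊠ G′
  ⊠-cong F≋F′ G≋G′ n = Σ-cong n (λ a _ → *-cong (F≋F′ a) (G≋G′ (n ∸ a)))

  ⊞-congˡ : ∀ H {F G} → F ≋ G → H ⊞ F ≋ H ⊞ G
  ⊞-congˡ H F≋G n = +-congˡ (F≋G n)

  ⊟-cong : ∀ {F G} → F ≋ G → ⊟ F ≋ ⊟ G
  ⊟-cong F≋G n = -‿cong (F≋G n)

  ⊠-congˡ : ∀ H {F G} → F ≋ G → H ⊠ F ≋ H ⊠ G
  ⊠-congˡ H F≋G = ⊠-cong {H} {H} (λ _ → refl) F≋G

  ⊠-congʳ : ∀ H {F G} → F ≋ G → F ⊠ H ≋ G ⊠ H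
  ⊠-congʳ H F≋G = ⊠-cong F≋G (λ m → refl {H m})

  const : A → Ser
  const x zero    = x
  const x (suc n) = 0#

  ⊠-const : ∀ F x → F ⊠ const x ≋ (λ n → F n * x)
  ⊠-const F x n = begin
    Σ n (λ a → F a * const x (n ∸ a))
      ≈⟨ Σ-last n _ (λ a a<n → trans (*-congˡ (reflexive (above a<n))) (zeroʳ _)) ⟩
    F n * const x (n ∸ n)   ≡⟨ ≡.cong (λ m → F n * const x m) (n∸n≡0 n) ⟩
    F n * x                 ∎
    where
    above : ∀ {a n} → a < n → const x (n ∸ a) ≡ 0#
    above {zero}  {suc n} _         = ≡.refl
    above {suc a} {suc n} (s≤s a<n) = above a<n

  𝟏 : Ser
  𝟏 = const 1#

  ⊠-identityʳ : ∀ F → F ⊠ 𝟏 ≋ F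
  ⊠-identityʳ F n = trans (⊠-const F 1# n) (*-identityʳ (F n))

  ⊠-comm : ∀ F G → F ⊠ G ≋ G ⊠ F
  ⊠-comm F G n = begin
    Σ n (λ a → F a * G (n ∸ a))              ≈⟨ Σ-reverse n _ ⟩
    Σ n (λ a → F (n ∸ a) * G (n ∸ (n ∸ a)))  ≈⟨ Σ-cong n swap ⟩
    Σ n (λ a → G a * F (n ∸ a))              ∎
    where
    swap : ∀ a → a ≤ n → F (n ∸ a) * G (n ∸ (n ∸ a)) ≈ G a * F (n ∸ a)
    swap a a≤n = trans (*-comm _ _) (*-congʳ (reflexive (≡.cong G (m∸[m∸n]≡n a≤n))))

  ⊠-distribˡ : ∀ F G H → F ⊠ (G ⊞ H) ≋ F ⊠ G ⊞ F ⊠ H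
  ⊠-distribˡ F G H n = trans (Σ-cong n (λ a _ → distribˡ (F a) _ _)) (Σ-∙ n _ _)

  ⊠-distribʳ : ∀ F G H → (G ⊞ H) ⊠ F ≋ G ⊠ F ⊞ H ⊠ F
  ⊠-distribʳ F G H n = begin
    ((G ⊞ H) ⊠ F) n        ≈⟨ ⊠-comm (G ⊞ H) F n ⟩
    (F ⊠ (G ⊞ H)) n        ≈⟨ ⊠-distribˡ F G H n ⟩
    (F ⊠ G) n + (F ⊠ H) n  ≈⟨ +-cong (⊠-comm F G n) (⊠-comm F H n) ⟩
    (G ⊠ F) n + (H ⊠ F) n  ∎

  ⊠-assoc : ∀ F G H → (F ⊠ G) ⊠ H ≋ F ⊠ (G ⊠ H)
  ⊠-assoc F G H n = begin
    Σ n (λ b → Σ b (λ a → F a * G (b ∸ a)) * H (n ∸ b))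
      ≈⟨ Σ-cong n (λ b _ → Σ-distribʳ b _ _) ⟩
    Σ n (λ b → Σ b (λ a → F a * G (b ∸ a) * H (n ∸ b)))
      ≈⟨ Σ-triangle n (λ a b → F a * G (b ∸ a) * H (n ∸ b)) ⟩
    Σ n (λ a → Σ (n ∸ a) (λ d → F a * G (a ℕ.+ d ∸ a) * H (n ∸ (a ℕ.+ d))))
      ≈⟨ Σ-cong n (λ a _ → Σ-cong (n ∸ a) (λ d _ → trans (*-assoc _ _ _) (*-congˡ (reindex a d)))) ⟩
    Σ n (λ a → Σ (n ∸ a) (λ d → F a * (G d * H (n ∸ a ∸ d))))
      ≈⟨ Σ-cong n (λ a _ → Σ-distribˡ (n ∸ a) _ _) ⟨
    Σ n (λ a → F a * Σ (n ∸ a) (λ d → G d * H (n ∸ a ∸ d))) ∎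
    where
    reindex : ∀ a d → G (a ℕ.+ d ∸ a) * H (n ∸ (a ℕ.+ d)) ≈ G d * H (n ∸ a ∸ d)
    reindex a d = *-cong (reflexive (≡.cong G (m+n∸m≡n a d)))
                         (reflexive (≡.cong H (≡.sym (∸-+-assoc n a d))))

  seriesIsCommutativeRing : IsCommutativeRing _≋_ _⊞_ _⊠_ ⊟ 𝟘 𝟏
  seriesIsCommutativeRing = record
    { isRing = record
      { +-isAbelianGroup = Pointwise.isAbelianGroup ℕ +-isAbelianGroup
      ; *-cong           = ⊠-cong
      ; *-assoc          = ⊠-assoc
      ; *-identity       = (λ F n → trans (⊠-comm 𝟏 F n) (⊠-identityʳ F n)) , ⊠-identityʳ
      ; distrib          = ⊠-distribˡ , ⊠-distribʳ
      }
    ; *-comm = ⊠-comm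
    }

  seriesRing : CommutativeRing c ℓ
  seriesRing = record { isCommutativeRing = seriesIsCommutativeRing }

  private
    module S = CommutativeRing seriesRing
    module ≋ = SetoidReasoning S.setoid
  open S public using () renaming (trans to ≋-trans)
  open import Algebra.Properties.CommutativeSemigroup S.*-commutativeSemigroup
    using () renaming (interchange to ⊠-interchange)

  pow : Ser → ℕ → Ser
  pow = power seriesRing

  pow-one : ∀ F → pow F 1 ≋ F
  pow-one F = S.trans (⊠-comm 𝟏 F) (⊠-identityʳ F)

  pow-⊠ : ∀ F G n → pow (F ⊠ G) n ≋ pow F n ⊠ pow G n
  pow-⊠ F G zero    = S.sym (⊠-identityʳ 𝟏)
  pow-⊠ F G (suc n) = S.trans (⊠-congʳ (F ⊠ G) (pow-⊠ F G n)) (⊠-interchange _ _ F G)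

  pow-const : ∀ x n → pow (const x) n ≋ const (power R x n)
  pow-const x zero    = S.refl
  pow-const x (suc n) = S.trans (⊠-congʳ (const x) (pow-const x n)) (S.trans (⊠-const _ x) scaled)
    where
    scaled : (λ m → const (power R x n) m * x) ≋ const (power R x n * x)
    scaled zero    = refl
    scaled (suc m) = zeroˡ x

  shift : ℕ → Ser → Ser
  shift zero    F n       = F n
  shift (suc k) F zero    = 0#
  shift (suc k) F (suc n) = shift k F n

  shift-cong : ∀ k {F G} → F ≋ G → shift k F ≋ shift k G
  shift-cong zero    F≋G n       = F≋G n
  shift-cong (suc k) F≋G zero    = refl
  shift-cong (suc k) F≋G (suc n) = shift-cong k F≋G n

  shift-shift : ∀ k l F → shift k (shift l F) ≋ shift (k ℕ.+ l) F
  shift-shift zero    l F n       = refl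
  shift-shift (suc k) l F zero    = refl
  shift-shift (suc k) l F (suc n) = shift-shift k l F n

  shift-below : ∀ k F {n} → n < k → shift k F n ≈ 0#
  shift-below (suc k) F {zero}  _         = refl
  shift-below (suc k) F {suc n} (s≤s n<k) = shift-below k F n<k

  shift-above : ∀ k F {n} → k ≤ n → shift k F n ≈ F (n ∸ k)
  shift-above zero    F         _         = refl
  shift-above (suc k) F {suc n} (s≤s k≤n) = shift-above k F k≤n

  shift-diagonal : ∀ k F → shift k F k ≈ F 0
  shift-diagonal zero    F = refl
  shift-diagonal (suc k) F = shift-diagonal k F

  shift-𝟘 : ∀ k {F} → F ≋ 𝟘 → shift k F ≋ 𝟘
  shift-𝟘 zero    F≋0 n       = F≋0 n
  shift-𝟘 (suc k) F≋0 zero    = refl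
  shift-𝟘 (suc k) F≋0 (suc n) = shift-𝟘 k F≋0 n

  shift-concentrated : ∀ k F → (∀ n → F (suc n) ≈ 0#) → ∀ {n} → n ≢ k → shift k F n ≈ 0#
  shift-concentrated zero    F F₊≈0 {zero}  0≢0 = ⊥-elim (0≢0 ≡.refl)
  shift-concentrated zero    F F₊≈0 {suc n} _   = F₊≈0 n
  shift-concentrated (suc k) F F₊≈0 {zero}  _   = refl
  shift-concentrated (suc k) F F₊≈0 {suc n} n≢k = shift-concentrated k F F₊≈0 (λ n≡k → n≢k (≡.cong suc n≡k))

  ⊠-shift1 : ∀ F G → F ⊠ shift 1 G ≋ shift 1 (F ⊠ G)
  ⊠-shift1 F G zero    = zeroʳ _
  ⊠-shift1 F G (suc n) = begin
    Σ n (λ a → F a * shift 1 G (suc n ∸ a)) + F (suc n) * shift 1 G (n ∸ n)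
      ≈⟨ +-cong (Σ-cong n (λ a a≤n → *-congˡ (reflexive (≡.cong (shift 1 G) (+-∸-assoc 1 a≤n)))))
                (*-congˡ (reflexive (≡.cong (shift 1 G) (n∸n≡0 n)))) ⟩
    (F ⊠ G) n + F (suc n) * 0#  ≈⟨ +-congˡ (zeroʳ _) ⟩
    (F ⊠ G) n + 0#              ≈⟨ +-identityʳ _ ⟩
    (F ⊠ G) n                   ∎

  X : Ser
  X = shift 1 𝟏

  ⊠-powX : ∀ F k → F ⊠ pow X k ≋ shift k F
  ⊠-powX F zero    = ⊠-identityʳ F
  ⊠-powX F (suc k) =
    S.trans (S.sym (⊠-assoc F (pow X k) X))
    (S.trans (⊠-shift1 (F ⊠ pow X k) 𝟏)
    (S.trans (shift-cong 1 (S.trans (⊠-identityʳ _) (⊠-powX F k))) (shift-shift 1 k F)))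

  ⊠-X : ∀ F → F ⊠ X ≋ shift 1 F
  ⊠-X F = S.trans (⊠-congˡ F (S.sym (pow-one X))) (⊠-powX F 1)

  ⊠-powX² : ∀ F k → F ⊠ pow (pow X 2) k ≋ shift (k ℕ.+ k) F
  ⊠-powX² F zero    = ⊠-identityʳ F
  ⊠-powX² F (suc k) = ≋.begin
    F ⊠ (pow X² k ⊠ X²)            ≋.≈⟨ ⊠-assoc F (pow X² k) X² ⟨
    (F ⊠ pow X² k) ⊠ X²            ≋.≈⟨ ⊠-powX _ 2 ⟩
    shift 2 (F ⊠ pow X² k)         ≋.≈⟨ shift-cong 2 (⊠-powX² F k) ⟩
    shift 2 (shift (k ℕ.+ k) F)    ≋.≈⟨ shift-shift 2 (k ℕ.+ k) F ⟩
    shift (2 ℕ.+ (k ℕ.+ k)) F      ≋.≡⟨ ≡.cong (λ m → shift (suc m) F) (≡.sym (+-suc k k)) ⟩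
    shift (suc k ℕ.+ suc k) F      ≋.∎
    where X² = pow X 2

  -- Σ_t s t for a sequence in which s t has order ≥ t: the n-th coefficient
  -- only involves s 0, …, s n.
  sumSeq : (ℕ → Ser) → Ser
  sumSeq s n = Σ n (λ t → s t n)

  -- 1 / F = Σ_t (1 - F)^t, meaningful when F 0 ≈ 1
  inverse : Ser → Ser
  inverse F = sumSeq (λ t → pow (𝟏 ⊞ ⊟ F) t)

  pow-order : ∀ E → E 0 ≈ 0# → ∀ t {a} → a < t → pow E t a ≈ 0#
  pow-order E E₀≈0 (suc t) {a} (s≤s a≤t) = Σ-vanish a (λ b b≤a → vanish b (b <? t))
    where
    vanish : ∀ b → Dec (b < t) → pow E t b * E (a ∸ b) ≈ 0#
    vanish b (yes b<t) = trans (*-congʳ (pow-order E E₀≈0 t b<t)) (zeroˡ _)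
    vanish b (no b≮t)  = trans (*-congˡ (trans (reflexive (≡.cong E a∸b≡0)) E₀≈0)) (zeroʳ _)
      where a∸b≡0 = m≤n⇒m∸n≡0 (≤-trans a≤t (≮⇒≥ b≮t))

  ⊠-one-minus : ∀ x E → x ⊠ (𝟏 ⊞ ⊟ E) ≋ x ⊞ ⊟ (x ⊠ E)
  ⊠-one-minus x E n = trans (⊠-distribˡ x 𝟏 (⊟ E) n) (+-cong (⊠-identityʳ x n) negate)
    where
    negate : (x ⊠ ⊟ E) n ≈ - (x ⊠ E) n
    negate = trans (Σ-cong n (λ a _ → sym (-‿distribʳ-* (x a) _))) (sym (Σ-negate n _))

  module _ (F : Ser) (F₀≈1 : F 0 ≈ 1#) where
    private
      E : Ser
      E = 𝟏 ⊞ ⊟ F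

      F≋1-E : F ≋ 𝟏 ⊞ ⊟ E
      F≋1-E n = sym (begin
        𝟏 n + - (𝟏 n + - F n)    ≈⟨ +-congˡ (sym (-‿+-comm _ _)) ⟩
        𝟏 n + (- 𝟏 n + - - F n)  ≈⟨ +-assoc _ _ _ ⟨
        (𝟏 n + - 𝟏 n) + - - F n  ≈⟨ +-cong (-‿inverseʳ _) (-‿involutive _) ⟩
        0# + F n                 ≈⟨ +-identityˡ _ ⟩
        F n                      ∎)

      ⊠F : ∀ x → x ⊠ F ≋ x ⊞ ⊟ (x ⊠ E)
      ⊠F x = S.trans (⊠-congˡ x F≋1-E) (⊠-one-minus x E)

      partial : ℕ → Ser
      partial N a = Σ N (λ t → pow E t a)

      telescope : ∀ N → partial N ⊠ F ≋ 𝟏 ⊞ ⊟ (pow E (suc N))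
      telescope zero    = ⊠F 𝟏
      telescope (suc N) n = begin
        ((partial N ⊞ p) ⊠ F) n              ≈⟨ ⊠-distribʳ F (partial N) p n ⟩
        (partial N ⊠ F) n + (p ⊠ F) n        ≈⟨ +-cong (telescope N n) (⊠F p n) ⟩
        (𝟏 n + - p n) + (p n + - pE n)       ≈⟨ +-assoc _ _ _ ⟩
        𝟏 n + (- p n + (p n + - pE n))       ≈⟨ +-congˡ (+-assoc _ _ _) ⟨
        𝟏 n + ((- p n + p n) + - pE n)       ≈⟨ +-congˡ (+-congʳ (-‿inverseˡ _)) ⟩
        𝟏 n + (0# + - pE n)                  ≈⟨ +-congˡ (+-identityˡ _) ⟩
        𝟏 n + - pE n                         ∎
        where
        p  = pow E (suc N)
        pE = p ⊠ E

      E₀≈0 : E 0 ≈ 0#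
      E₀≈0 = trans (+-congˡ (-‿cong F₀≈1)) (-‿inverseʳ 1#)

    inverse-inverseˡ : inverse F ⊠ F ≋ 𝟏
    inverse-inverseˡ n = begin
      Σ n (λ a → inverse F a * F (n ∸ a))  ≈⟨ Σ-cong n (λ a a≤n → *-congʳ (truncate a a≤n)) ⟨
      Σ n (λ a → partial n a * F (n ∸ a))  ≈⟨ telescope n n ⟩
      𝟏 n + - pow E (suc n) n              ≈⟨ +-congˡ (trans (-‿cong (pow-order E E₀≈0 (suc n) ≤-refl)) -0#≈0#) ⟩
      𝟏 n + 0#                             ≈⟨ +-identityʳ _ ⟩
      𝟏 n                                  ∎
      where
      -- the a-th coefficient of the geometric series stabilises from N = a on
      truncate : ∀ a → a ≤ n → partial n a ≈ inverse F a
      truncate a a≤n = begin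
        Σ n (λ t → pow E t a)            ≡⟨ ≡.cong (λ m → Σ m (λ t → pow E t a)) (m∸n+n≡m a≤n) ⟨
        Σ ((n ∸ a) ℕ.+ a) (λ t → pow E t a)  ≈⟨ Σ-extend a (n ∸ a) _ (λ t a<t → pow-order E E₀≈0 t a<t) ⟩
        Σ a (λ t → pow E t a)            ∎

  inverse-unique : ∀ {F G H} → G ⊠ F ≋ 𝟏 → H ⊠ F ≋ 𝟏 → G ≋ H
  inverse-unique {F} {G} {H} GF≋1 HF≋1 = ≋.begin
    G                ≋.≈⟨ ⊠-identityʳ G ⟨
    G ⊠ 𝟏            ≋.≈⟨ ⊠-congˡ G HF≋1 ⟨
    G ⊠ (H ⊠ F)      ≋.≈⟨ ⊠-congˡ G (⊠-comm H F) ⟩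
    G ⊠ (F ⊠ H)      ≋.≈⟨ ⊠-assoc G F H ⟨
    (G ⊠ F) ⊠ H      ≋.≈⟨ ⊠-congʳ H GF≋1 ⟩
    𝟏 ⊠ H            ≋.≈⟨ ⊠-comm 𝟏 H ⟩
    H ⊠ 𝟏            ≋.≈⟨ ⊠-identityʳ H ⟩
    H                ≋.∎

  inverse-𝟏 : inverse 𝟏 ≋ 𝟏
  inverse-𝟏 = inverse-unique {𝟏} (inverse-inverseˡ 𝟏 refl) (⊠-identityʳ 𝟏)

-- Two counting functions for selections from the odd numbers.  Sums are
-- integers, so that subtracting a part never needs a side condition; both
-- functions vanish at negative sums.
module OddCounts where
  open import Data.Integer using (_+_; _-_; -_; _*_)
  open ℕₚ using (≤-refl; m<n⇒m<1+n; +-identityʳ; +-suc)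
  open import Algebra.Properties.CommutativeSemigroup ℤₚ.+-commutativeSemigroup
    using (interchange; xy∙z≈xz∙y)
  open ≡ using (refl; cong; cong₂; sym; trans; module ≡-Reasoning)

  δ : ℤ → ℤ
  δ (+ zero) = 1ℤ
  δ _        = 0ℤ

  -- multisets k m x: the number of m-element multisets of {1, 3, …, 2k-1}
  -- with sum x; multisets (k+1) splits on whether the largest part 2k+1 occurs.
  multisets : ℕ → ℕ → ℤ → ℤ
  multisets zero    zero    x = δ x
  multisets zero    (suc m) x = 0ℤ
  multisets (suc k) zero    x = multisets k zero x
  multisets (suc k) (suc m) x = multisets k (suc m) x + multisets (suc k) m (x + -[1+ (k ℕ.+ k) ])

  -- subsets n c x: the number of c-element subsets of {1, 3, …, 2n-1} with
  -- sum x; subsets (n+1) splits on whether the largest element 2n+1 occurs.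
  subsets : ℕ → ℕ → ℤ → ℤ
  subsets zero    zero    x = δ x
  subsets zero    (suc c) x = 0ℤ
  subsets (suc n) zero    x = subsets n zero x
  subsets (suc n) (suc c) x = subsets n (suc c) x + subsets n c (x + -[1+ (n ℕ.+ n) ])

  multisets-negative : ∀ k m t → multisets k m -[1+ t ] ≡ 0ℤ
  multisets-negative zero    zero    t = refl
  multisets-negative zero    (suc m) t = refl
  multisets-negative (suc k) zero    t = multisets-negative k zero t
  multisets-negative (suc k) (suc m) t =
    cong₂ _+_ (multisets-negative k (suc m) t) (multisets-negative (suc k) m _)

  subsets-negative : ∀ n c t → subsets n c -[1+ t ] ≡ 0ℤ
  subsets-negative zero    zero    t = refl
  subsets-negative zero    (suc c) t = refl
  subsets-negative (suc n) zero    t = subsets-negative n zero t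
  subsets-negative (suc n) (suc c) t =
    cong₂ _+_ (subsets-negative n (suc c) t) (subsets-negative n c _)

  subsets-oversized : ∀ n c x → n < c → subsets n c x ≡ 0ℤ
  subsets-oversized zero    (suc c) x _         = refl
  subsets-oversized (suc n) (suc c) x (s≤s n<c) =
    cong₂ _+_ (subsets-oversized n (suc c) x (m<n⇒m<1+n n<c)) (subsets-oversized n c _ n<c)

  multisets-empty : ∀ k x → multisets k zero x ≡ δ x
  multisets-empty zero    x = refl
  multisets-empty (suc k) x = multisets-empty k x

  -- The only n-element subset is {1, 3, …, 2n-1}, whose sum is n².
  subsets-full : ∀ n x → subsets n n x ≡ δ (x - + n * + n)
  subsets-full zero    (+ zero)  = refl
  subsets-full zero    (+ suc x) = refl
  subsets-full zero    -[1+ x ]  = refl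
  subsets-full (suc n) x =
    trans (cong₂ _+_ (subsets-oversized n (suc n) x ≤-refl) (subsets-full n _))
          (trans (ℤₚ.+-identityˡ _) (cong δ (shift x (+ n))))
    where
    shift : ∀ x n → x + - (1ℤ + (n + n)) - n * n ≡ x - (1ℤ + n) * (1ℤ + n)
    shift = solve-∀

  -- Recursion on the smallest element 1: remove it if present, and subtract 2
  -- from every remaining element.
  subsets-smallest : ∀ n c x →
    subsets (suc n) (suc c) x ≡ subsets n (suc c) (x + -[1+ suc (c ℕ.+ c) ]) + subsets n c (x + -[1+ (c ℕ.+ c) ])
  subsets-smallest zero    zero    x = refl
  subsets-smallest zero    (suc c) x = refl
  subsets-smallest (suc n) zero x = begin
    subsets (suc n) 1 x + subsets n 0 (x + -[1+ (suc n ℕ.+ suc n) ])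
      ≡⟨ cong₂ _+_ (subsets-smallest n zero x) (cong (subsets n zero) (reorder x (+ n))) ⟩
    (A + B) + C  ≡⟨ xy∙z≈xz∙y A B C ⟩
    (A + C) + B  ∎
    where
    open ≡-Reasoning
    A = subsets n 1 (x + -[1+ 1 ])
    B = subsets n 0 (x + -[1+ 0 ])
    C = subsets n 0 (x + -[1+ 1 ] + -[1+ (n ℕ.+ n) ])
    reorder : ∀ x n → x + - (1ℤ + ((1ℤ + n) + (1ℤ + n))) ≡ x + - (1ℤ + (1ℤ + (0ℤ + 0ℤ))) + - (1ℤ + (n + n))
    reorder = solve-∀
  subsets-smallest (suc n) (suc c) x = begin
    subsets (suc n) (suc (suc c)) x + subsets (suc n) (suc c) (x + -[1+ (suc n ℕ.+ suc n) ])
      ≡⟨ cong₂ _+_ (subsets-smallest n (suc c) x) (subsets-smallest n c _) ⟩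
    (A + B) + (subsets n (suc c) (x + -[1+ (suc n ℕ.+ suc n) ] + -[1+ suc (c ℕ.+ c) ])
               + subsets n c (x + -[1+ (suc n ℕ.+ suc n) ] + -[1+ (c ℕ.+ c) ]))
      ≡⟨ cong₂ (λ u v → (A + B) + (subsets n (suc c) u + subsets n c v))
               (reorder₁ x (+ n) (+ c)) (reorder₂ x (+ n) (+ c)) ⟩
    (A + B) + (C + D)  ≡⟨ interchange A B C D ⟩
    (A + C) + (B + D)  ∎
    where
    open ≡-Reasoning
    A = subsets n (suc (suc c)) (x + -[1+ suc (suc c ℕ.+ suc c) ])
    B = subsets n (suc c) (x + -[1+ (suc c ℕ.+ suc c) ])
    C = subsets n (suc c) (x + -[1+ suc (suc c ℕ.+ suc c) ] + -[1+ (n ℕ.+ n) ])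
    D = subsets n c (x + -[1+ (suc c ℕ.+ suc c) ] + -[1+ (n ℕ.+ n) ])
    reorder₁ : ∀ x n c → x + - (1ℤ + ((1ℤ + n) + (1ℤ + n))) + - (1ℤ + (1ℤ + (c + c)))
                       ≡ x + - (1ℤ + (1ℤ + ((1ℤ + c) + (1ℤ + c)))) + - (1ℤ + (n + n))
    reorder₁ = solve-∀
    reorder₂ : ∀ x n c → x + - (1ℤ + ((1ℤ + n) + (1ℤ + n))) + - (1ℤ + (c + c))
                       ≡ x + - (1ℤ + ((1ℤ + c) + (1ℤ + c))) + - (1ℤ + (n + n))
    reorder₂ = solve-∀

  -- Both counts are given by the Gaussian binomial coefficient [k+m, k] in q²:
  -- Σ_x multisets (k+1) m x q^x = q^m [k+m, k]_(q²) and
  -- Σ_x subsets (k+m) k x q^x = q^(k²) [k+m, k]_(q²).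
  multisets≡subsets : ∀ k m x → multisets (suc k) m x ≡ subsets (k ℕ.+ m) k (x + + k * + k - + m)
  multisets≡subsets k zero x =
    trans (multisets-empty (suc k) x)
          (sym (trans (cong (λ n → subsets n k (x + + k * + k - + 0)) (+-identityʳ k))
                      (trans (subsets-full k _) (cong δ (cancel x (+ k * + k))))))
    where
    cancel : ∀ x s → x + s - 0ℤ - s ≡ x
    cancel = solve-∀
  multisets≡subsets zero (suc m) x =
    trans (ℤₚ.+-identityˡ _) (trans (multisets≡subsets zero m (x + -[1+ 0 ])) (cong (subsets m zero) (shift x (+ m))))
    where
    shift : ∀ x m → (x + - 1ℤ) + 0ℤ * 0ℤ - m ≡ x + 0ℤ * 0ℤ - (1ℤ + m)
    shift = solve-∀
  multisets≡subsets (suc k) (suc m) x = begin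
    multisets (suc k) (suc m) x + multisets (suc (suc k)) m (x + -[1+ (suc k ℕ.+ suc k) ])
      ≡⟨ cong₂ _+_ (multisets≡subsets k (suc m) x) (multisets≡subsets (suc k) m _) ⟩
    U + V ≡⟨ ℤₚ.+-comm U V ⟩
    V + U ≡⟨ cong₂ _+_ (cong₂ (λ n z → subsets n (suc k) z) (sym (+-suc k m)) (eqA x (+ k) (+ m)))
                       (cong (subsets (k ℕ.+ suc m) k) (eqB x (+ k) (+ m))) ⟩
    subsets (k ℕ.+ suc m) (suc k) (y + -[1+ suc (k ℕ.+ k) ]) + subsets (k ℕ.+ suc m) k (y + -[1+ (k ℕ.+ k) ])
      ≡⟨ sym (subsets-smallest (k ℕ.+ suc m) k y) ⟩
    subsets (suc k ℕ.+ suc m) (suc k) y ∎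
    where
    open ≡-Reasoning
    y = x + + suc k * + suc k - + suc m
    U = subsets (k ℕ.+ suc m) k (x + + k * + k - + suc m)
    V = subsets (suc k ℕ.+ m) (suc k) ((x + -[1+ (suc k ℕ.+ suc k) ]) + + suc k * + suc k - + m)
    eqA : ∀ x k m → (x + - (1ℤ + ((1ℤ + k) + (1ℤ + k)))) + (1ℤ + k) * (1ℤ + k) - m
                  ≡ (x + (1ℤ + k) * (1ℤ + k) - (1ℤ + m)) + - (1ℤ + (1ℤ + (k + k)))
    eqA = solve-∀
    eqB : ∀ x k m → x + k * k - (1ℤ + m) ≡ (x + (1ℤ + k) * (1ℤ + k) - (1ℤ + m)) + - (1ℤ + (k + k))
    eqB = solve-∀

open OddCounts
open ℕₚ using (≤-trans; m≤n+m; m+[n∸m]≡n; ≰⇒>)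

-- ℤ[[z]], ℤ[[z]][[y]] and ℤ[[z]][[y]][[q]]: the last has the same carrier as
-- Series, and its coefficientwise equality is ∀ i j k → F i j k ≡ G i j k.
module Rz   = PowerSeries ℤₚ.+-*-commutativeRing
module Ryz  = PowerSeries Rz.seriesRing
module Rqyz = PowerSeries Ryz.seriesRing

open Rqyz using (_≋_; _⊞_; ⊟; _⊠_; 𝟏; const; pow; shift; sumSeq; inverse)

private
  module ≋ = CommutativeRing Rqyz.seriesRing
  module ≋-Reasoning = SetoidReasoning ≋.setoid

Xq Xy Xz : Rqyz.Ser
Xq = Rqyz.X
Xy = const Ryz.X
Xz = const (Ryz.const Rz.X)

Σ-coeffʸᶻ : ∀ n (f : ℕ → Ryz.Ser) j k → Rqyz.Σ n f j k ≡ Rz.Σ n (λ a → f a j k)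
Σ-coeffʸᶻ zero    f j k = ≡.refl
Σ-coeffʸᶻ (suc n) f j k = ≡.cong (ℤ._+ f (suc n) j k) (Σ-coeffʸᶻ n f j k)

Σ-coeffᶻ : ∀ n (f : ℕ → Rz.Ser) k → Ryz.Σ n f k ≡ Rz.Σ n (λ a → f a k)
Σ-coeffᶻ zero    f k = ≡.refl
Σ-coeffᶻ (suc n) f k = ≡.cong (ℤ._+ f (suc n) k) (Σ-coeffᶻ n f k)

Σ≡sumTo : ∀ n f → Rz.Σ n f ≡ sumTo n f
Σ≡sumTo zero    f = ≡.refl
Σ≡sumTo (suc n) f = ≡.cong (ℤ._+ f (suc n)) (Σ≡sumTo n f)

sumSeq-coeff : ∀ s i j k → sumSeq s i j k ≡ Rz.Σ i (λ t → s t i j k)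
sumSeq-coeff s i = Σ-coeffʸᶻ i (λ t → s t i)

sumTo-cong : ∀ n {f g : ℕ → ℤ} → (∀ a → f a ≡ g a) → sumTo n f ≡ sumTo n g
sumTo-cong zero    f≡g = f≡g zero
sumTo-cong (suc n) f≡g = ≡.cong₂ ℤ._+_ (sumTo-cong n f≡g) (f≡g (suc n))

⊗≋⊠ : ∀ F G → F ⊗ G ≋ F ⊠ G
⊗≋⊠ F G i j k = ≡.sym (begin
  (F ⊠ G) i j k
    ≡⟨ Σ-coeffʸᶻ i _ j k ⟩
  Rz.Σ i (λ a → Ryz.Σ j (λ b → F a b Rz.⊠ G (i ∸ a) (j ∸ b)) k)
    ≡⟨ Rz.Σ-cong i (λ a _ → Σ-coeffᶻ j _ k) ⟩
  Rz.Σ i (λ a → Rz.Σ j (λ b → Rz.Σ k (λ c → F a b c ℤ.* G (i ∸ a) (j ∸ b) (k ∸ c))))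
    ≡⟨ Σ≡sumTo i _ ⟩
  sumTo i (λ a → Rz.Σ j (λ b → Rz.Σ k (λ c → F a b c ℤ.* G (i ∸ a) (j ∸ b) (k ∸ c))))
    ≡⟨ sumTo-cong i (λ a → ≡.trans (Σ≡sumTo j _) (sumTo-cong j (λ b → Σ≡sumTo k _))) ⟩
  (F ⊗ G) i j k ∎)
  where
  open ≡.≡-Reasoning

𝟙≋𝟏 : 𝟙 ≋ 𝟏
𝟙≋𝟏 zero    zero    zero    = ≡.refl
𝟙≋𝟏 zero    zero    (suc k) = ≡.refl
𝟙≋𝟏 zero    (suc j) k       = ≡.refl
𝟙≋𝟏 (suc i) j       k       = ≡.refl

qS≋Xq : qS ≋ Xq
qS≋Xq zero                j       k       = ≡.refl
qS≋Xq (suc zero)          zero    zero    = ≡.refl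
qS≋Xq (suc zero)          zero    (suc k) = ≡.refl
qS≋Xq (suc zero)          (suc j) k       = ≡.refl
qS≋Xq (suc (suc i))       j       k       = ≡.refl

yS≋Xy : yS ≋ Xy
yS≋Xy zero    zero             k       = ≡.refl
yS≋Xy zero    (suc zero)       zero    = ≡.refl
yS≋Xy zero    (suc zero)       (suc k) = ≡.refl
yS≋Xy zero    (suc (suc j))    k       = ≡.refl
yS≋Xy (suc i) j                k       = ≡.refl

zS≋Xz : zS ≋ Xz
zS≋Xz zero    zero    zero          = ≡.refl
zS≋Xz zero    zero    (suc zero)    = ≡.refl
zS≋Xz zero    zero    (suc (suc k)) = ≡.refl
zS≋Xz zero    (suc j) k             = ≡.refl
zS≋Xz (suc i) j       k             = ≡.refl

⊗-cong : ∀ {F F′ G G′} → F ≋ F′ → G ≋ G′ → F ⊗ G ≋ F′ ⊠ G′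
⊗-cong {F} {F′} {G} {G′} F≋F′ G≋G′ = ≋.trans (⊗≋⊠ F G) (Rqyz.⊠-cong {F} {F′} {G} {G′} F≋F′ G≋G′)

⊕-cong : ∀ {F F′ G G′} → F ≋ F′ → G ≋ G′ → F ⊕ G ≋ F′ ⊞ G′
⊕-cong F≋F′ G≋G′ i j k = ≡.cong₂ ℤ._+_ (F≋F′ i j k) (G≋G′ i j k)

⊖-cong : ∀ {F F′} → F ≋ F′ → ⊖ F ≋ ⊟ F′
⊖-cong F≋F′ i j k = ≡.cong ℤ.-_ (F≋F′ i j k)

^ˢ-cong : ∀ {F F′} n → F ≋ F′ → F ^ˢ n ≋ pow F′ n
^ˢ-cong zero    F≋F′ = 𝟙≋𝟏
^ˢ-cong (suc n) F≋F′ = ⊗-cong (^ˢ-cong n F≋F′) F≋F′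

qPoch : Rqyz.Ser → Rqyz.Ser → ℕ → Rqyz.Ser
qPoch a b zero    = 𝟏
qPoch a b (suc n) = qPoch a b n ⊠ (𝟏 ⊞ ⊟ (a ⊠ pow b n))

poch-cong : ∀ {a a′ b b′} n → a ≋ a′ → b ≋ b′ → poch a b n ≋ qPoch a′ b′ n
poch-cong zero    a≋a′ b≋b′ = 𝟙≋𝟏
poch-cong (suc n) a≋a′ b≋b′ = ⊗-cong (poch-cong n a≋a′ b≋b′) (⊕-cong 𝟙≋𝟏 (⊖-cong (⊗-cong a≋a′ (^ˢ-cong n b≋b′))))

∑∞-cong : ∀ {s s′} → (∀ t → s t ≋ s′ t) → ∑∞ s ≋ sumSeq s′
∑∞-cong {s} {s′} s≋s′ i j k = begin
  sumTo i (λ t → s t i j k)       ≡⟨ sumTo-cong i (λ t → s≋s′ t i j k) ⟩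
  sumTo i (λ t → s′ t i j k)      ≡⟨ Σ≡sumTo i _ ⟨
  Rz.Σ i (λ t → s′ t i j k)       ≡⟨ sumSeq-coeff s′ i j k ⟨
  sumSeq s′ i j k                 ∎
  where open ≡.≡-Reasoning

inv-cong : ∀ {F F′} → F ≋ F′ → inv F ≋ inverse F′
inv-cong F≋F′ = ∑∞-cong (λ t → ^ˢ-cong t (⊕-cong 𝟙≋𝟏 (⊖-cong F≋F′)))

P : ℕ → Rqyz.Ser
P = qPoch (Xy ⊠ Xq) (pow Xq 2)

G : ℕ → Rqyz.Ser
G k = inverse (P k)

C : ℕ → Rqyz.Ser
C = qPoch (⊟ (Xz ⊠ Xq)) (pow Xq 2)

ν-term : ℕ → Rqyz.Ser
ν-term n = ((pow Xy n ⊠ pow Xz n) ⊠ pow Xq (n ℕ.* n ℕ.+ n)) ⊠ G (suc n)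

rhs-term : ℕ → Rqyz.Ser
rhs-term n = C n ⊠ pow (Xy ⊠ Xq) n

ν≋ : ν ≋ sumSeq ν-term
ν≋ = ∑∞-cong λ n →
  ⊗-cong (⊗-cong (⊗-cong (^ˢ-cong n yS≋Xy) (^ˢ-cong n zS≋Xz)) (^ˢ-cong (n ℕ.* n ℕ.+ n) qS≋Xq))
         (inv-cong (poch-cong (suc n) (⊗-cong yS≋Xy qS≋Xq) (^ˢ-cong 2 qS≋Xq)))

rhs≋ : rhs ≋ sumSeq rhs-term
rhs≋ = ∑∞-cong λ n → ⊗-cong (poch-cong n (⊖-cong (⊗-cong zS≋Xz qS≋Xq)) (^ˢ-cong 2 qS≋Xq))
                            (^ˢ-cong n (⊗-cong yS≋Xy qS≋Xq))

shiftʸ : ℕ → Rqyz.Ser → Rqyz.Ser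
shiftʸ n F i = Ryz.shift n (F i)

shiftᶻ : ℕ → Rqyz.Ser → Rqyz.Ser
shiftᶻ n F i j = Rz.shift n (F i j)

⊠-powXy : ∀ F n → F ⊠ pow Xy n ≋ shiftʸ n F
⊠-powXy F n = ≋.trans (Rqyz.⊠-congˡ F (Rqyz.pow-const Ryz.X n))
              (≋.trans (Rqyz.⊠-const F _) (λ i → Ryz.⊠-powX (F i) n))

⊠-powXz : ∀ F n → F ⊠ pow Xz n ≋ shiftᶻ n F
⊠-powXz F n = ≋.trans (Rqyz.⊠-congˡ F (Rqyz.pow-const (Ryz.const Rz.X) n))
              (≋.trans (Rqyz.⊠-const F _) λ i →
                Ryz.≋-trans (Ryz.⊠-congˡ (F i) (Ryz.pow-const Rz.X n))
                (Ryz.≋-trans (Ryz.⊠-const (F i) _) (λ j → Rz.⊠-powX (F i j) n)))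

⊠-Xy : ∀ F → F ⊠ Xy ≋ shiftʸ 1 F
⊠-Xy F = ≋.trans (Rqyz.⊠-congˡ F (≋.sym (Rqyz.pow-one Xy))) (⊠-powXy F 1)

⊠-Xz : ∀ F → F ⊠ Xz ≋ shiftᶻ 1 F
⊠-Xz F = ≋.trans (Rqyz.⊠-congˡ F (≋.sym (Rqyz.pow-one Xz))) (⊠-powXz F 1)

open import Algebra.Properties.CommutativeSemigroup ≋.*-commutativeSemigroup using (xy∙z≈xz∙y)
open import Algebra.Properties.Ring ≋.ring using (-‿distribˡ-*; -‿distribʳ-*; -‿involutive; //-rightDividesˡ)

⊠-Wq^odd : ∀ W F k → F ⊠ ((W ⊠ Xq) ⊠ pow (pow Xq 2) k) ≋ shift (suc (k ℕ.+ k)) (F ⊠ W)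
⊠-Wq^odd W F k = begin
  F ⊠ ((W ⊠ Xq) ⊠ Q²ᵏ)             ≈⟨ Rqyz.⊠-congˡ F (xy∙z≈xz∙y W Xq Q²ᵏ) ⟩
  F ⊠ ((W ⊠ Q²ᵏ) ⊠ Xq)             ≈⟨ Rqyz.⊠-assoc F (W ⊠ Q²ᵏ) Xq ⟨
  (F ⊠ (W ⊠ Q²ᵏ)) ⊠ Xq             ≈⟨ Rqyz.⊠-congʳ Xq (Rqyz.⊠-assoc F W Q²ᵏ) ⟨
  ((F ⊠ W) ⊠ Q²ᵏ) ⊠ Xq             ≈⟨ Rqyz.⊠-X _ ⟩
  shift 1 ((F ⊠ W) ⊠ Q²ᵏ)          ≈⟨ Rqyz.shift-cong 1 (Rqyz.⊠-powX² (F ⊠ W) k) ⟩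
  shift 1 (shift (k ℕ.+ k) (F ⊠ W)) ≈⟨ Rqyz.shift-shift 1 (k ℕ.+ k) (F ⊠ W) ⟩
  shift (suc (k ℕ.+ k)) (F ⊠ W)    ∎
  where
  open ≋-Reasoning
  Q²ᵏ = pow (pow Xq 2) k

⊠-factorʸ : ∀ F k → F ⊠ (𝟏 ⊞ ⊟ ((Xy ⊠ Xq) ⊠ pow (pow Xq 2) k)) ≋ F ⊞ ⊟ (shift (suc (k ℕ.+ k)) (shiftʸ 1 F))
⊠-factorʸ F k = ≋.trans (Rqyz.⊠-one-minus F ((Xy ⊠ Xq) ⊠ pow (pow Xq 2) k))
  (Rqyz.⊞-congˡ F (Rqyz.⊟-cong (≋.trans (⊠-Wq^odd Xy F k) (Rqyz.shift-cong (suc (k ℕ.+ k)) (⊠-Xy F)))))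

⊠-factorᶻ : ∀ F k → F ⊠ (𝟏 ⊞ ⊟ (⊟ (Xz ⊠ Xq) ⊠ pow (pow Xq 2) k)) ≋ F ⊞ shift (suc (k ℕ.+ k)) (shiftᶻ 1 F)
⊠-factorᶻ F k = begin
  F ⊠ (𝟏 ⊞ ⊟ (⊟ a ⊠ b))   ≈⟨ Rqyz.⊠-one-minus F (⊟ a ⊠ b) ⟩
  F ⊞ ⊟ (F ⊠ (⊟ a ⊠ b))   ≈⟨ Rqyz.⊞-congˡ F (Rqyz.⊟-cong (Rqyz.⊠-congˡ F (≋.sym (-‿distribˡ-* a b)))) ⟩
  F ⊞ ⊟ (F ⊠ ⊟ (a ⊠ b))   ≈⟨ Rqyz.⊞-congˡ F (Rqyz.⊟-cong (≋.sym (-‿distribʳ-* F (a ⊠ b)))) ⟩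
  F ⊞ ⊟ (⊟ (F ⊠ (a ⊠ b))) ≈⟨ Rqyz.⊞-congˡ F (-‿involutive (F ⊠ (a ⊠ b))) ⟩
  F ⊞ F ⊠ (a ⊠ b)         ≈⟨ Rqyz.⊞-congˡ F (≋.trans (⊠-Wq^odd Xz F k) (Rqyz.shift-cong (suc (k ℕ.+ k)) (⊠-Xz F))) ⟩
  F ⊞ shift (suc (k ℕ.+ k)) (shiftᶻ 1 F) ∎
  where
  open ≋-Reasoning
  a = Xz ⊠ Xq
  b = pow (pow Xq 2) k

shift-coeff : ∀ n F i j k → shift n F i j k ≡ Rz.shift n (λ i′ → F i′ j k) i
shift-coeff zero    F i       j k = ≡.refl
shift-coeff (suc n) F zero    j k = ≡.refl
shift-coeff (suc n) F (suc i) j k = shift-coeff n F i j k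

shiftʸ-coeff : ∀ n F i j k → shiftʸ n F i j k ≡ Rz.shift n (λ j′ → F i j′ k) j
shiftʸ-coeff zero    F i j       k = ≡.refl
shiftʸ-coeff (suc n) F i zero    k = ≡.refl
shiftʸ-coeff (suc n) F i (suc j) k = shiftʸ-coeff n F i j k

shift-ℤ : ∀ (h : ℤ → ℤ) → (∀ t → h -[1+ t ] ≡ 0ℤ) → ∀ n i → Rz.shift n (λ i′ → h (+ i′)) i ≡ h (+ i ℤ.- + n)
shift-ℤ h h₋≡0 zero    i       = ≡.cong h (≡.sym (ℤₚ.+-identityʳ (+ i)))
shift-ℤ h h₋≡0 (suc n) zero    = ≡.sym (h₋≡0 n)
shift-ℤ h h₋≡0 (suc n) (suc i) = ≡.trans (shift-ℤ h h₋≡0 n i) (≡.cong h (begin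
  + i ℤ.- + n          ≡⟨ ℤₚ.m-n≡m⊖n i n ⟩
  i ℤ.⊖ n              ≡⟨ ℤₚ.[1+m]⊖[1+n]≡m⊖n i n ⟨
  suc i ℤ.⊖ suc n      ≡⟨ ℤₚ.m-n≡m⊖n (suc i) (suc n) ⟨
  + suc i ℤ.- + suc n  ∎))
  where open ≡.≡-Reasoning

P-constant : ∀ k → P k 0 Ryz.≋ Ryz.𝟏
P-constant zero    j c = ≡.refl
P-constant (suc k) j c = ≡.trans (⊠-factorʸ (P k) k 0 j c) (≡.trans (ℤₚ.+-identityʳ _) (P-constant k j c))

-- G (k+1) (1 - yq^(2k+1)) = G k, since (yq;q²)_(k+1) = (yq;q²)_k (1 - yq^(2k+1)).
G-step : ∀ k → G (suc k) ⊠ (𝟏 ⊞ ⊟ ((Xy ⊠ Xq) ⊠ pow (pow Xq 2) k)) ≋ G k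
G-step k = Rqyz.inverse-unique {P k} times-P (Rqyz.inverse-inverseˡ (P k) (P-constant k))
  where
  L = 𝟏 ⊞ ⊟ ((Xy ⊠ Xq) ⊠ pow (pow Xq 2) k)
  times-P : (G (suc k) ⊠ L) ⊠ P k ≋ 𝟏
  times-P = ≋.trans (Rqyz.⊠-assoc (G (suc k)) L (P k))
            (≋.trans (Rqyz.⊠-congˡ (G (suc k)) (Rqyz.⊠-comm L (P k)))
            (Rqyz.inverse-inverseˡ (P (suc k)) (P-constant (suc k))))

G-recursion : ∀ k → G (suc k) ≋ G k ⊞ shift (suc (k ℕ.+ k)) (shiftʸ 1 (G (suc k)))
G-recursion k = begin
  G (suc k)                      ≈⟨ //-rightDividesˡ S (G (suc k)) ⟨
  (G (suc k) ⊞ ⊟ S) ⊞ S          ≈⟨ ≋.+-congʳ (⊠-factorʸ (G (suc k)) k) ⟨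
  (G (suc k) ⊠ L) ⊞ S            ≈⟨ ≋.+-congʳ (G-step k) ⟩
  G k ⊞ S                        ∎
  where
  open ≋-Reasoning
  S = shift (suc (k ℕ.+ k)) (shiftʸ 1 (G (suc k)))
  L = 𝟏 ⊞ ⊟ ((Xy ⊠ Xq) ⊠ pow (pow Xq 2) k)

G-z-free : ∀ k i j c → G k i j (suc c) ≡ 0ℤ
G-z-free zero    i       j       c = ≡.trans (Rqyz.inverse-𝟏 i j (suc c)) (𝟏-z-free i j)
  where
  𝟏-z-free : ∀ i j → 𝟏 i j (suc c) ≡ 0ℤ
  𝟏-z-free zero    zero    = ≡.refl
  𝟏-z-free zero    (suc j) = ≡.refl
  𝟏-z-free (suc i) j       = ≡.refl
G-z-free (suc k) i j c = ≡.trans (G-recursion k i j (suc c))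
  (≡.cong₂ ℤ._+_ (G-z-free k i j c)
                 (≡.trans (shift-coeff (suc (k ℕ.+ k)) (shiftʸ 1 (G (suc k))) i j (suc c))
                          (Rz.shift-𝟘 (suc (k ℕ.+ k)) (λ i′ → shifted i′ j) i)))
  where
  shifted : ∀ i′ j → shiftʸ 1 (G (suc k)) i′ j (suc c) ≡ 0ℤ
  shifted i′ zero    = ≡.refl
  shifted i′ (suc j) = G-z-free (suc k) i′ j c

G-coeff : ∀ k i j → G k i j 0 ≡ multisets k j (+ i)
G-coeff zero i j = ≡.trans (Rqyz.inverse-𝟏 i j 0) (𝟏-coeff i j)
  where
  𝟏-coeff : ∀ i j → 𝟏 i j 0 ≡ multisets 0 j (+ i)
  𝟏-coeff zero    zero    = ≡.refl
  𝟏-coeff zero    (suc j) = ≡.refl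
  𝟏-coeff (suc i) zero    = ≡.refl
  𝟏-coeff (suc i) (suc j) = ≡.refl
G-coeff (suc k) i zero = ≡.trans (G-recursion k i 0 0)
  (≡.trans (≡.cong₂ ℤ._+_ (G-coeff k i 0) (≡.trans (shift-coeff n S i 0 0) (Rz.shift-𝟘 n (λ _ → ≡.refl) i)))
           (ℤₚ.+-identityʳ _))
  where
  n = suc (k ℕ.+ k)
  S = shiftʸ 1 (G (suc k))
G-coeff (suc k) i (suc j) = ≡.trans (G-recursion k i (suc j) 0)
  (≡.cong₂ ℤ._+_ (G-coeff k i (suc j)) (begin
    shift n S i (suc j) 0                              ≡⟨ shift-coeff n S i (suc j) 0 ⟩
    Rz.shift n (λ i′ → G (suc k) i′ j 0) i             ≡⟨ Rz.shift-cong n (λ i′ → G-coeff (suc k) i′ j) i ⟩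
    Rz.shift n (λ i′ → multisets (suc k) j (+ i′)) i   ≡⟨ shift-ℤ (multisets (suc k) j) (multisets-negative (suc k) j) n i ⟩
    multisets (suc k) j (+ i ℤ.- + n)                  ∎))
  where
  open ≡.≡-Reasoning
  n = suc (k ℕ.+ k)
  S = shiftʸ 1 (G (suc k))

C-recursion : ∀ n → C (suc n) ≋ C n ⊞ shift (suc (n ℕ.+ n)) (shiftᶻ 1 (C n))
C-recursion n = ⊠-factorᶻ (C n) n

C-y-free : ∀ n i j c → C n i (suc j) c ≡ 0ℤ
C-y-free zero    zero    j c = ≡.refl
C-y-free zero    (suc i) j c = ≡.refl
C-y-free (suc n) i j c = ≡.trans (C-recursion n i (suc j) c)
  (≡.cong₂ ℤ._+_ (C-y-free n i j c)
                 (≡.trans (shift-coeff m (shiftᶻ 1 (C n)) i (suc j) c) (Rz.shift-𝟘 m (λ i′ → shifted i′ c) i)))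
  where
  m = suc (n ℕ.+ n)
  shifted : ∀ i′ c → shiftᶻ 1 (C n) i′ (suc j) c ≡ 0ℤ
  shifted i′ zero    = ≡.refl
  shifted i′ (suc c) = C-y-free n i′ j c

C-coeff : ∀ n i c → C n i 0 c ≡ subsets n c (+ i)
C-coeff zero    zero    zero    = ≡.refl
C-coeff zero    zero    (suc c) = ≡.refl
C-coeff zero    (suc i) zero    = ≡.refl
C-coeff zero    (suc i) (suc c) = ≡.refl
C-coeff (suc n) i zero = ≡.trans (C-recursion n i 0 0)
  (≡.trans (≡.cong₂ ℤ._+_ (C-coeff n i 0) (≡.trans (shift-coeff m S i 0 0) (Rz.shift-𝟘 m (λ _ → ≡.refl) i)))
           (ℤₚ.+-identityʳ _))
  where
  m = suc (n ℕ.+ n)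
  S = shiftᶻ 1 (C n)
C-coeff (suc n) i (suc c) = ≡.trans (C-recursion n i 0 (suc c))
  (≡.cong₂ ℤ._+_ (C-coeff n i (suc c)) (begin
    shift m S i 0 (suc c)                         ≡⟨ shift-coeff m S i 0 (suc c) ⟩
    Rz.shift m (λ i′ → C n i′ 0 c) i              ≡⟨ Rz.shift-cong m (λ i′ → C-coeff n i′ c) i ⟩
    Rz.shift m (λ i′ → subsets n c (+ i′)) i      ≡⟨ shift-ℤ (subsets n c) (subsets-negative n c) m i ⟩
    subsets n c (+ i ℤ.- + m)                     ∎))
  where
  open ≡.≡-Reasoning
  m = suc (n ℕ.+ n)
  S = shiftᶻ 1 (C n)

ν-term-shifted : ∀ n → ν-term n ≋ shift (n ℕ.* n ℕ.+ n) (shiftᶻ n (shiftʸ n (G (suc n))))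
ν-term-shifted n = begin
  ((Yⁿ ⊠ Zⁿ) ⊠ Qᵐ) ⊠ H      ≈⟨ Rqyz.⊠-comm ((Yⁿ ⊠ Zⁿ) ⊠ Qᵐ) H ⟩
  H ⊠ ((Yⁿ ⊠ Zⁿ) ⊠ Qᵐ)      ≈⟨ Rqyz.⊠-assoc H (Yⁿ ⊠ Zⁿ) Qᵐ ⟨
  (H ⊠ (Yⁿ ⊠ Zⁿ)) ⊠ Qᵐ      ≈⟨ Rqyz.⊠-congʳ Qᵐ (Rqyz.⊠-assoc H Yⁿ Zⁿ) ⟨
  ((H ⊠ Yⁿ) ⊠ Zⁿ) ⊠ Qᵐ      ≈⟨ Rqyz.⊠-powX _ m ⟩
  shift m ((H ⊠ Yⁿ) ⊠ Zⁿ)   ≈⟨ Rqyz.shift-cong m (⊠-powXz (H ⊠ Yⁿ) n) ⟩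
  shift m (shiftᶻ n (H ⊠ Yⁿ)) ≈⟨ Rqyz.shift-cong m (λ i j → Rz.shift-cong n (⊠-powXy H n i j)) ⟩
  shift m (shiftᶻ n (shiftʸ n H)) ∎
  where
  open ≋-Reasoning
  m = n ℕ.* n ℕ.+ n
  H = G (suc n)
  Yⁿ = pow Xy n
  Zⁿ = pow Xz n
  Qᵐ = pow Xq m

rhs-term-shifted : ∀ n → rhs-term n ≋ shift n (shiftʸ n (C n))
rhs-term-shifted n = begin
  C n ⊠ pow (Xy ⊠ Xq) n            ≈⟨ Rqyz.⊠-congˡ (C n) (Rqyz.pow-⊠ Xy Xq n) ⟩
  C n ⊠ (pow Xy n ⊠ pow Xq n)      ≈⟨ Rqyz.⊠-assoc (C n) (pow Xy n) (pow Xq n) ⟨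
  (C n ⊠ pow Xy n) ⊠ pow Xq n      ≈⟨ Rqyz.⊠-powX _ n ⟩
  shift n (C n ⊠ pow Xy n)         ≈⟨ Rqyz.shift-cong n (⊠-powXy (C n) n) ⟩
  shift n (shiftʸ n (C n))         ∎
  where open ≋-Reasoning

ν-term-coeff : ∀ n i j k → ν-term n i j k ≡
  Rz.shift (n ℕ.* n ℕ.+ n) (λ i′ → Rz.shift n (λ k′ → Rz.shift n (λ j′ → G (suc n) i′ j′ k′) j) k) i
ν-term-coeff n i j k = ≡.trans (ν-term-shifted n i j k)
  (≡.trans (shift-coeff m _ i j k) (Rz.shift-cong m (λ i′ → Rz.shift-cong n (λ k′ → shiftʸ-coeff n (G (suc n)) i′ j k′) k) i))
  where m = n ℕ.* n ℕ.+ n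

rhs-term-coeff : ∀ n i j k → rhs-term n i j k ≡ Rz.shift n (λ i′ → Rz.shift n (λ j′ → C n i′ j′ k) j) i
rhs-term-coeff n i j k = ≡.trans (rhs-term-shifted n i j k)
  (≡.trans (shift-coeff n _ i j k) (Rz.shift-cong n (λ i′ → shiftʸ-coeff n (C n) i′ j k) i))

-- Coefficient of q^i y^j z^k on the right: only the summand n = j contributes.
rhs-coeff : ∀ i j k → rhs i j k ≡ subsets j k (+ i ℤ.- + j)
rhs-coeff i j k = begin
  rhs i j k                                       ≡⟨ rhs≋ i j k ⟩
  sumSeq rhs-term i j k                           ≡⟨ sumSeq-coeff rhs-term i j k ⟩
  Rz.Σ i (λ n → rhs-term n i j k)                 ≡⟨ Rz.Σ-single i j _ off early ⟩
  rhs-term j i j k                                ≡⟨ rhs-term-coeff j i j k ⟩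
  Rz.shift j (λ i′ → Rz.shift j (λ j′ → C j i′ j′ k) j) i
                                                  ≡⟨ Rz.shift-cong j (λ i′ → Rz.shift-diagonal j _) i ⟩
  Rz.shift j (λ i′ → C j i′ 0 k) i                ≡⟨ Rz.shift-cong j (λ i′ → C-coeff j i′ k) i ⟩
  Rz.shift j (λ i′ → subsets j k (+ i′)) i        ≡⟨ shift-ℤ (subsets j k) (subsets-negative j k) j i ⟩
  subsets j k (+ i ℤ.- + j)                       ∎
  where
  open ≡.≡-Reasoning
  -- (-zq;q²)_n (yq)^n only has terms of y-degree n
  off : ∀ n → n ≢ j → rhs-term n i j k ≡ 0ℤ
  off n n≢j = ≡.trans (rhs-term-coeff n i j k)
    (Rz.shift-𝟘 n (λ i′ → Rz.shift-concentrated n _ (λ j′ → C-y-free n i′ j′ k) (λ j≡n → n≢j (≡.sym j≡n))) i)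
  -- and only terms of q-degree ≥ n
  early : i < j → rhs-term j i j k ≡ 0ℤ
  early i<j = ≡.trans (rhs-term-coeff j i j k) (Rz.shift-below j _ i<j)

exponent-shift : ∀ i k m → (+ i ℤ.- + (k ℕ.* k ℕ.+ k)) ℤ.+ + k ℤ.* + k ℤ.- + m ≡ + i ℤ.- + (k ℕ.+ m)
exponent-shift i k m = begin
  (+ i ℤ.- + (k ℕ.* k ℕ.+ k)) ℤ.+ + k ℤ.* + k ℤ.- + m
    ≡⟨ ≡.cong (λ a → (+ i ℤ.- a) ℤ.+ + k ℤ.* + k ℤ.- + m)
              (≡.trans (ℤₚ.pos-+ (k ℕ.* k) k) (≡.cong (ℤ._+ + k) (ℤₚ.pos-* k k))) ⟩
  (+ i ℤ.- (+ k ℤ.* + k ℤ.+ + k)) ℤ.+ + k ℤ.* + k ℤ.- + m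
    ≡⟨ cancel (+ i) (+ k) (+ m) ⟩
  + i ℤ.- (+ k ℤ.+ + m)
    ≡⟨ ≡.cong (λ a → + i ℤ.- a) (ℤₚ.pos-+ k m) ⟨
  + i ℤ.- + (k ℕ.+ m) ∎
  where
  open ≡.≡-Reasoning
  cancel : ∀ i k m → (i ℤ.- (k ℤ.* k ℤ.+ k)) ℤ.+ k ℤ.* k ℤ.- m ≡ i ℤ.- (k ℤ.+ m)
  cancel = solve-∀

-- Coefficient of q^i y^j z^k on the left: only the summand n = k contributes.
ν-coeff : ∀ i j k → ν i j k ≡ subsets j k (+ i ℤ.- + j)
ν-coeff i j k = begin
  ν i j k                                    ≡⟨ ν≋ i j k ⟩
  sumSeq ν-term i j k                        ≡⟨ sumSeq-coeff ν-term i j k ⟩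
  Rz.Σ i (λ n → ν-term n i j k)              ≡⟨ Rz.Σ-single i k _ off early ⟩
  ν-term k i j k                             ≡⟨ ν-term-coeff k i j k ⟩
  Rz.shift m (λ i′ → Rz.shift k (λ k′ → Rz.shift k (λ j′ → G (suc k) i′ j′ k′) j) k) i
                                             ≡⟨ Rz.shift-cong m (λ i′ → Rz.shift-diagonal k _) i ⟩
  Rz.shift m (λ i′ → Rz.shift k (λ j′ → G (suc k) i′ j′ 0) j) i
                                             ≡⟨ Rz.shift-cong m (λ i′ → Rz.shift-cong k (λ j′ → G-coeff (suc k) i′ j′) j) i ⟩
  Rz.shift m (λ i′ → Rz.shift k (λ j′ → multisets (suc k) j′ (+ i′)) j) i
                                             ≡⟨ count (k ℕ.≤? j) ⟩
  subsets j k (+ i ℤ.- + j)                  ∎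
  where
  open ≡.≡-Reasoning
  m = k ℕ.* k ℕ.+ k
  -- y^n z^n q^(n²+n)/(yq;q²)_(n+1) only has terms of z-degree n
  off : ∀ n → n ≢ k → ν-term n i j k ≡ 0ℤ
  off n n≢k = ≡.trans (ν-term-coeff n i j k)
    (Rz.shift-𝟘 (n ℕ.* n ℕ.+ n)
      (λ i′ → Rz.shift-concentrated n _ (λ k′ → Rz.shift-𝟘 n (λ j′ → G-z-free (suc n) i′ j′ k′) j)
                                        (λ k≡n → n≢k (≡.sym k≡n))) i)
  -- and only terms of q-degree ≥ n² + n ≥ n
  early : i < k → ν-term k i j k ≡ 0ℤ
  early i<k = ≡.trans (ν-term-coeff k i j k) (Rz.shift-below m _ (≤-trans i<k (m≤n+m k (k ℕ.* k))))
  -- the multisets with j - k parts correspond to the k-subsets of {1, 3, …, 2j-1}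
  count : Dec (k ≤ j) →
    Rz.shift m (λ i′ → Rz.shift k (λ j′ → multisets (suc k) j′ (+ i′)) j) i ≡ subsets j k (+ i ℤ.- + j)
  count (yes k≤j) = begin
    Rz.shift m (λ i′ → Rz.shift k (λ j′ → multisets (suc k) j′ (+ i′)) j) i
      ≡⟨ Rz.shift-cong m (λ i′ → Rz.shift-above k _ k≤j) i ⟩
    Rz.shift m (λ i′ → multisets (suc k) (j ∸ k) (+ i′)) i
      ≡⟨ shift-ℤ (multisets (suc k) (j ∸ k)) (multisets-negative (suc k) (j ∸ k)) m i ⟩
    multisets (suc k) (j ∸ k) (+ i ℤ.- + m)
      ≡⟨ multisets≡subsets k (j ∸ k) _ ⟩
    subsets (k ℕ.+ (j ∸ k)) k ((+ i ℤ.- + m) ℤ.+ + k ℤ.* + k ℤ.- + (j ∸ k))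
      ≡⟨ ≡.cong (subsets (k ℕ.+ (j ∸ k)) k) (exponent-shift i k (j ∸ k)) ⟩
    subsets (k ℕ.+ (j ∸ k)) k (+ i ℤ.- + (k ℕ.+ (j ∸ k)))
      ≡⟨ ≡.cong (λ n → subsets n k (+ i ℤ.- + n)) (m+[n∸m]≡n k≤j) ⟩
    subsets j k (+ i ℤ.- + j) ∎
  count (no k≰j) = begin
    Rz.shift m (λ i′ → Rz.shift k (λ j′ → multisets (suc k) j′ (+ i′)) j) i
      ≡⟨ Rz.shift-𝟘 m (λ i′ → Rz.shift-below k _ (≰⇒> k≰j)) i ⟩
    0ℤ
      ≡⟨ subsets-oversized j k _ (≰⇒> k≰j) ⟨
    subsets j k (+ i ℤ.- + j) ∎

theorem3 : (i j k : ℕ) → ν i j k ≡ rhs i j k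
theorem3 i j k = ≡.trans (ν-coeff i j k) (≡.sym (rhs-coeff i j k))
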